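{- Let $D^-\subseteq\mathbb{F}_4^{11}$ be the additive code defined in the context. Then $D^-$ is uniformly packed (with packing radius $e=2$, minimum distance $5$) with packing constants $(\lambda,\mu)=(4,5)$; that is, for every $x\in\mathbb{F}_4^{11}$, the number of codewords of $D^-$ at Hamming distance $3$ from $x$ equals $4$ if $x$ is at distance exactly $2$ from $D^-$, and equals $5$ if $x$ is at distance at least $3$ from $D^-$.
   Context: $\mathbb{F}_4=\{0,1,\omega,\omega^2\}$ with $\omega^2=\omega+1$. An additive code of length $n$ over $\mathbb{F}_4$ is an additive subgroup of $\mathbb{F}_4^n$ (equivalently an $\mathbb{F}_2$-subspace). Distances and weights are Hamming. $D^-$ is the $\mathbb{F}_2$-span of the following $12$ vectors of $\mathbb{F}_4^{11}$ (it is equivalent to the code obtained by puncturing the dodecacode, an additive $(12,4^6,6)$ code, in any coordinate): $(0,0,0,0,0,\omega^2,\omega^2,0,\omega,1,\omega)$, $(0,0,0,0,0,\omega,0,\omega,\omega,\omega,1)$, $(1,0,0,0,0,1,0,1,\omega^2,\omega^2,1)$, $(\omega,0,0,0,0,0,\omega,1,\omega,\omega,\omega)$, $(0,1,0,0,0,0,1,1,1,\omega^2,\omega^2)$, $(0,\omega,0,0,0,\omega^2,1,\omega^2,\omega,\omega,0)$, $(0,0,1,0,0,\omega,\omega,1,1,0,1)$, $(0,0,\omega,0,0,\omega,1,\omega,\omega^2,\omega^2,0)$, $(0,0,0,1,0,\omega,\omega,\omega,0,1,\omega)$, $(0,0,0,\omega,0,\omega^2,1,1,\omega^2,0,\omega)$,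 $(0,0,0,0,1,\omega^2,\omega^2,\omega^2,1,0,\omega^2)$, $(0,0,0,0,\omega,\omega,1,0,1,\omega,\omega)$. It has $4^6$ codewords and minimum distance $5$. -}

module Defs where

open import Data.Nat using (ℕ; zero; suc; _≟_)
open import Data.Bool using (Bool; true; false)
open import Data.Vec using (Vec; []; _∷_; zipWith; replicate; foldr)
open import Data.List using (List; []; _∷_; concatMap; map; length; filter)
open import Data.Product using (Σ; _×_; _,_)
open import Relation.Binary.PropositionalEquality using (_≡_)
open import Relation.Nullary using (Dec; yes; no)
open import Relation.Nullary.Decidable using (_×-dec_)
open import Data.List.Relation.Unary.Any using (Any; any?)

-- The field F4 = {0, 1, ω, ω²} with ω² = ω + 1
data F4 : Set where
  O I w w² : F4

_⊕_ : F4 → F4 → F4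
O ⊕ y = y
x ⊕ O = x
I ⊕ I = O
I ⊕ w = w²
I ⊕ w² = w
w ⊕ I = w²
w ⊕ w = O
w ⊕ w² = I
w² ⊕ I = w
w² ⊕ w = I
w² ⊕ w² = O

_≟F_ : (x y : F4) → Dec (x ≡ y)
O ≟F O = yes _≡_.refl
I ≟F I = yes _≡_.refl
w ≟F w = yes _≡_.refl
w² ≟F w² = yes _≡_.refl
O ≟F I = no λ ()
O ≟F w = no λ ()
O ≟F w² = no λ ()
I ≟F O = no λ ()
I ≟F w = no λ ()
I ≟F w² = no λ ()
w ≟F O = no λ ()
w ≟F I = no λ ()
w ≟F w² = no λ ()
w² ≟F O = no λ ()
w² ≟F I = no λ ()
w² ≟F w = no λ ()

Word : Set
Word = Vec F4 11

_+W_ : ∀ {n} → Vec F4 n → Vec F4 n → Vec F4 n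
_+W_ = zipWith _⊕_

_≟W_ : ∀ {n} → (x y : Vec F4 n) → Dec (x ≡ y)
[] ≟W [] = yes _≡_.refl
(a ∷ x) ≟W (b ∷ y) with a ≟F b | x ≟W y
... | yes _≡_.refl | yes _≡_.refl = yes _≡_.refl
... | no ne | _ = no λ { _≡_.refl → ne _≡_.refl }
... | yes _ | no ne = no λ { _≡_.refl → ne _≡_.refl }

dist : ∀ {n} → Vec F4 n → Vec F4 n → ℕ
dist [] [] = 0
dist (a ∷ x) (b ∷ y) with a ≟F b
... | yes _ = dist x y
... | no _ = suc (dist x y)

-- the 12 generators of D⁻ over F2
gens : Vec Word 12
gens =
    (O ∷ O ∷ O ∷ O ∷ O ∷ w² ∷ w² ∷ O ∷ w ∷ I ∷ w ∷ [])
  ∷ (O ∷ O ∷ O ∷ O ∷ O ∷ w ∷ O ∷ w ∷ w ∷ w ∷ I ∷ [])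
  ∷ (I ∷ O ∷ O ∷ O ∷ O ∷ I ∷ O ∷ I ∷ w² ∷ w² ∷ I ∷ [])
  ∷ (w ∷ O ∷ O ∷ O ∷ O ∷ O ∷ w ∷ I ∷ w ∷ w ∷ w ∷ [])
  ∷ (O ∷ I ∷ O ∷ O ∷ O ∷ O ∷ I ∷ I ∷ I ∷ w² ∷ w² ∷ [])
  ∷ (O ∷ w ∷ O ∷ O ∷ O ∷ w² ∷ I ∷ w² ∷ w ∷ w ∷ O ∷ [])
  ∷ (O ∷ O ∷ I ∷ O ∷ O ∷ w ∷ w ∷ I ∷ I ∷ O ∷ I ∷ [])
  ∷ (O ∷ O ∷ w ∷ O ∷ O ∷ w ∷ I ∷ w ∷ w² ∷ w² ∷ O ∷ [])
  ∷ (O ∷ O ∷ O ∷ I ∷ O ∷ w ∷ w ∷ w ∷ O ∷ I ∷ w ∷ [])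
  ∷ (O ∷ O ∷ O ∷ w ∷ O ∷ w² ∷ I ∷ I ∷ w² ∷ O ∷ w ∷ [])
  ∷ (O ∷ O ∷ O ∷ O ∷ I ∷ w² ∷ w² ∷ w² ∷ I ∷ O ∷ w² ∷ [])
  ∷ (O ∷ O ∷ O ∷ O ∷ w ∷ w ∷ I ∷ O ∷ I ∷ w ∷ w ∷ [])
  ∷ []

zeroW : Word
zeroW = replicate _ O

comb : ∀ {k} → Vec Bool k → Vec Word k → Word
comb [] [] = zeroW
comb (true ∷ c) (g ∷ gs) = g +W comb c gs
comb (false ∷ c) (g ∷ gs) = comb c gs

_∈D : Word → Set
x ∈D = Σ (Vec Bool 12) λ c → comb c gens ≡ x

allVecs : ∀ {A : Set} → List A → (n : ℕ) → List (Vec A n)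
allVecs xs zero = [] ∷ []
allVecs xs (suc n) = concatMap (λ a → map (a ∷_) (allVecs xs n)) xs

allCoeffs : List (Vec Bool 12)
allCoeffs = allVecs (true ∷ false ∷ []) 12

allWords : List Word
allWords = allVecs (O ∷ I ∷ w ∷ w² ∷ []) 11

∈D? : (x : Word) → Dec (Any (λ c → comb c gens ≡ x) allCoeffs)
∈D? x = any? (λ c → comb c gens ≟W x) allCoeffs

countAtDist : ℕ → Word → ℕ
countAtDist r x =
  length (filter (λ y → ∈D? y ×-dec (dist x y ≟ r)) allWords)

-- D⁻ is the kernel of the additive syndrome map of the parity check H₀: the generators have
-- syndrome 0, and conversely a word of syndrome 0 agrees on its first six coordinates with a
-- combination of generators, and the difference vanishes because H₀ is the identity on the last
-- five coordinates. Translating by x, the codewords at distance k from x correspond to the words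
-- of weight k whose syndrome is that of x, so their number depends only on the syndrome. For all
-- 4⁵ syndromes these coset weight counts (weights 0 to 3) are computed column by column, splitting
-- on the first coordinate, and checked against the packing condition.
module Submission where

open import Defs
open import Data.Bool using (Bool; true; false; _xor_)
open import Data.Bool.ListAction using (any)
open import Data.Fin using (toℕ)
open import Data.List using (List; []; _∷_; _++_; map; length; filter; concatMap)
open import Data.List.Properties using (filter-≐; filter-++; filter-none; filter-some; length-++; map-cong)
open import Data.List.Membership.Propositional using (_∈_; lose)
open import Data.List.Membership.Propositional.Properties using (∈-map⁺; ∈-concatMap⁺)
open import Data.List.Relation.Unary.Any as Any using (Any; here; there; satisfied)
import Data.List.Relation.Unary.All as All
open import Data.List.Relation.Binary.Permutation.Propositional using (_↭_; refl; swap; ↭-trans)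
open import Data.List.Relation.Binary.Permutation.Propositional.Properties using (++-comm; map⁺)
open import Data.Nat using (ℕ; zero; suc; _+_; _≤_; _<_; _≟_; _≡ᵇ_; z<s; s<s)
open import Data.Nat.ListAction using (sum)
open import Data.Nat.ListAction.Properties using (sum-↭)
open import Data.Nat.Properties using (+-identityʳ; +-cancelˡ-≡; ≤⇒≯; n>0⇒n≢0; 1+n≢0)
open import Data.Product using (Σ; _×_; _,_; proj₁; proj₂)
open import Data.Vec using (Vec; []; _∷_; replicate; zipWith; take; drop; tabulate; foldr′)
  renaming (_++_ to _++ᵛ_; map to mapᵛ)
import Data.Vec.Relation.Unary.All as AllV
open import Data.Vec.Properties
  using (zipWith-assoc; zipWith-comm; zipWith-identityˡ; zipWith-identityʳ; take-zipWith; take++drop≡id)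
open import Function using (_∘_)
open import Relation.Binary.PropositionalEquality
open import Relation.Nullary using (Dec; ¬_; yes; no; contradiction)
open import Relation.Nullary.Decidable using (map′; _×-dec_; _→-dec_; ¬?; from-yes)
open import Relation.Unary using (Decidable; _≐_)

F4* : List F4
F4* = I ∷ w ∷ w² ∷ []

F4s : List F4
F4s = O ∷ I ∷ w ∷ w² ∷ []

∈-F4s : ∀ a → a ∈ F4s
∈-F4s O = here refl
∈-F4s I = there (here refl)
∈-F4s w = there (there (here refl))
∈-F4s w² = there (there (there (here refl)))

all-F4? : {P : F4 → Set} → Decidable P → Dec (∀ a → P a)
all-F4? P? = map′ (λ { (p₀ , _) O → p₀ ; (_ , p₁ , _) I → p₁
                     ; (_ , _ , p₂ , _) w → p₂ ; (_ , _ , _ , p₃) w² → p₃ })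
                  (λ p → p O , p I , p w , p w²)
                  (P? O ×-dec P? I ×-dec P? w ×-dec P? w²)

all-Vec? : ∀ {n} {P : Vec F4 n → Set} → Decidable P → Dec (∀ v → P v)
all-Vec? {zero} P? = map′ (λ { p [] → p }) (λ p → p []) (P? [])
all-Vec? {suc n} P? = map′ (λ { p (a ∷ v) → p a v }) (λ p a v → p (a ∷ v))
                           (all-F4? λ a → all-Vec? λ v → P? (a ∷ v))

⊕-assoc : ∀ a b c → (a ⊕ b) ⊕ c ≡ a ⊕ (b ⊕ c)
⊕-assoc = from-yes (all-F4? λ a → all-F4? λ b → all-F4? λ c → ((a ⊕ b) ⊕ c) ≟F (a ⊕ (b ⊕ c)))

⊕-comm : ∀ a b → a ⊕ b ≡ b ⊕ a
⊕-comm = from-yes (all-F4? λ a → all-F4? λ b → (a ⊕ b) ≟F (b ⊕ a))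

⊕-identityʳ : ∀ a → a ⊕ O ≡ a
⊕-identityʳ = from-yes (all-F4? λ a → (a ⊕ O) ≟F a)

⊕-self : ∀ a → a ⊕ a ≡ O
⊕-self = from-yes (all-F4? λ a → (a ⊕ a) ≟F O)

⊕-interchange : ∀ a b c d → (a ⊕ b) ⊕ (c ⊕ d) ≡ (a ⊕ c) ⊕ (b ⊕ d)
⊕-interchange = from-yes (all-F4? λ a → all-F4? λ b → all-F4? λ c → all-F4? λ d →
  ((a ⊕ b) ⊕ (c ⊕ d)) ≟F ((a ⊕ c) ⊕ (b ⊕ d)))

⊕≡O⇒≡ : ∀ a b → a ⊕ b ≡ O → a ≡ b
⊕≡O⇒≡ = from-yes (all-F4? λ a → all-F4? λ b → (a ⊕ b) ≟F O →-dec a ≟F b)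

0ᵛ : ∀ {n} → Vec F4 n
0ᵛ = replicate _ O

module _ {n : ℕ} where

  +W-assoc : (x y z : Vec F4 n) → (x +W y) +W z ≡ x +W (y +W z)
  +W-assoc = zipWith-assoc ⊕-assoc

  +W-comm : (x y : Vec F4 n) → x +W y ≡ y +W x
  +W-comm = zipWith-comm ⊕-comm

  +W-identityˡ : (x : Vec F4 n) → 0ᵛ +W x ≡ x
  +W-identityˡ = zipWith-identityˡ (λ _ → refl)

  +W-identityʳ : (x : Vec F4 n) → x +W 0ᵛ ≡ x
  +W-identityʳ = zipWith-identityʳ ⊕-identityʳ

+W-self : ∀ {n} (x : Vec F4 n) → x +W x ≡ 0ᵛ
+W-self [] = refl
+W-self (a ∷ x) = cong₂ _∷_ (⊕-self a) (+W-self x)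

+W-interchange : ∀ {n} (x y u v : Vec F4 n) → (x +W y) +W (u +W v) ≡ (x +W u) +W (y +W v)
+W-interchange [] [] [] [] = refl
+W-interchange (a ∷ x) (b ∷ y) (c ∷ u) (d ∷ v) =
  cong₂ _∷_ (⊕-interchange a b c d) (+W-interchange x y u v)

module _ {n : ℕ} where

  x+[x+y]≡y : (x y : Vec F4 n) → x +W (x +W y) ≡ y
  x+[x+y]≡y x y = begin
    x +W (x +W y) ≡⟨ +W-assoc x x y ⟨
    (x +W x) +W y ≡⟨ cong (_+W y) (+W-self x) ⟩
    0ᵛ +W y       ≡⟨ +W-identityˡ y ⟩
    y             ∎
    where open ≡-Reasoning

  x+y≡z⇒y≡x+z : {x y z : Vec F4 n} → x +W y ≡ z → y ≡ x +W z
  x+y≡z⇒y≡x+z {x} {y} eq = trans (sym (x+[x+y]≡y x y)) (cong (x +W_) eq)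

  x+y≡0⇒x≡y : {x y : Vec F4 n} → x +W y ≡ 0ᵛ → x ≡ y
  x+y≡0⇒x≡y {x} {y} eq = sym (trans (x+y≡z⇒y≡x+z eq) (+W-identityʳ x))

wt : ∀ {n} → Vec F4 n → ℕ
wt e = dist e 0ᵛ

dist≡wt : ∀ {n} (x y : Vec F4 n) → dist x y ≡ wt (x +W y)
dist≡wt [] [] = refl
dist≡wt (a ∷ x) (b ∷ y) with a ≟F b | (a ⊕ b) ≟F O
... | yes _   | yes _     = dist≡wt x y
... | no _    | no _      = cong suc (dist≡wt x y)
... | yes a≡b | no a⊕b≢O  = contradiction (trans (cong (a ⊕_) (sym a≡b)) (⊕-self a)) a⊕b≢O
... | no a≢b  | yes a⊕b≡O = contradiction (⊕≡O⇒≡ a b a⊕b≡O) a≢b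

module _ {A : Set} {P : A → Set} (P? : Decidable P) where

  count : List A → ℕ
  count xs = length (filter P? xs)

  count-++ : ∀ xs ys → count (xs ++ ys) ≡ count xs + count ys
  count-++ xs ys = trans (cong length (filter-++ P? xs ys)) (length-++ (filter P? xs))

  count-none : (∀ x → ¬ P x) → ∀ xs → count xs ≡ 0
  count-none ¬P xs = cong length (filter-none P? (All.universal ¬P xs))

  count-some : ∀ {x xs} → x ∈ xs → P x → 0 < count xs
  count-some x∈xs px = filter-some P? (lose x∈xs px)

count-≐ : ∀ {A : Set} {P Q : A → Set} (P? : Decidable P) (Q? : Decidable Q) → P ≐ Q →
          ∀ xs → count P? xs ≡ count Q? xs
count-≐ P? Q? P≐Q xs = cong length (filter-≐ P? Q? P≐Q xs)

count-map : ∀ {A B : Set} {P : B → Set} (P? : Decidable P) (f : A → B) xs →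
            count P? (map f xs) ≡ count (P? ∘ f) xs
count-map P? f [] = refl
count-map P? f (x ∷ xs) with P? (f x)
... | yes _ = cong suc (count-map P? f xs)
... | no _  = count-map P? f xs

∈-allVecs : ∀ {A : Set} {xs : List A} → (∀ a → a ∈ xs) → ∀ {n} (v : Vec A n) → v ∈ allVecs xs n
∈-allVecs all∈ [] = here refl
∈-allVecs all∈ (a ∷ v) = ∈-concatMap⁺ (λ b → map (b ∷_) (allVecs _ _))
  (Any.map (λ { refl → ∈-map⁺ (a ∷_) (∈-allVecs all∈ v) }) (all∈ a))

count-allVecs-suc : ∀ {A : Set} {n} {P : Vec A (suc n) → Set} (P? : Decidable P) xs →
  count P? (allVecs xs (suc n)) ≡ sum (map (λ a → count (λ v → P? (a ∷ v)) (allVecs xs n)) xs)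
count-allVecs-suc {n = n} P? xs = count-prefixed (allVecs xs n) xs
  where
  count-prefixed : ∀ vs as → count P? (concatMap (λ a → map (a ∷_) vs) as)
                               ≡ sum (map (λ a → count (λ v → P? (a ∷ v)) vs) as)
  count-prefixed vs [] = refl
  count-prefixed vs (a ∷ as) = begin
    count P? (map (a ∷_) vs ++ concatMap (λ b → map (b ∷_) vs) as)
      ≡⟨ count-++ P? (map (a ∷_) vs) _ ⟩
    count P? (map (a ∷_) vs) + count P? (concatMap (λ b → map (b ∷_) vs) as)
      ≡⟨ cong₂ _+_ (count-map P? (a ∷_) vs) (count-prefixed vs as) ⟩
    count (λ v → P? (a ∷ v)) vs + sum (map (λ b → count (λ v → P? (b ∷ v)) vs) as) ∎
    where open ≡-Reasoning

⊕-permutes : ∀ a → F4s ↭ map (a ⊕_) F4s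
⊕-permutes O = refl
⊕-permutes I = swap O I (swap w w² refl)
⊕-permutes w = ++-comm (O ∷ I ∷ []) (w ∷ w² ∷ [])
⊕-permutes w² = ↭-trans (⊕-permutes w) (swap w w² (swap O I refl))

sum-F4s-translate : ∀ a (g : F4 → ℕ) → sum (map g F4s) ≡ sum (map (λ b → g (a ⊕ b)) F4s)
sum-F4s-translate a g = sum-↭ (map⁺ g (⊕-permutes a))

countVecs : ∀ {n} {P : Vec F4 n → Set} → Decidable P → ℕ
countVecs {n} P? = count P? (allVecs F4s n)

countVecs-translate : ∀ {n} {P : Vec F4 n → Set} (P? : Decidable P) (x : Vec F4 n) →
                      countVecs P? ≡ countVecs (λ e → P? (x +W e))
countVecs-translate P? [] =
  count-≐ P? (λ e → P? ([] +W e)) ((λ { {[]} p → p }) , (λ { {[]} p → p })) ([] ∷ [])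
countVecs-translate {suc n} P? (a ∷ x) = begin
  countVecs P?
    ≡⟨ count-allVecs-suc P? F4s ⟩
  sum (map (λ b → countVecs (λ e → P? (b ∷ e))) F4s)
    ≡⟨ sum-F4s-translate a (λ b → countVecs (λ e → P? (b ∷ e))) ⟩
  sum (map (λ b → countVecs (λ e → P? ((a ⊕ b) ∷ e))) F4s)
    ≡⟨ cong sum (map-cong (λ b → countVecs-translate (λ e → P? ((a ⊕ b) ∷ e)) x) F4s) ⟩
  sum (map (λ b → countVecs (λ e → P? ((a ⊕ b) ∷ (x +W e)))) F4s)
    ≡⟨ count-allVecs-suc (λ e → P? ((a ∷ x) +W e)) F4s ⟨
  countVecs (λ e → P? ((a ∷ x) +W e)) ∎
  where open ≡-Reasoning

Column : ℕ → Set
Column r = Vec F4 r × Vec F4 r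

-- A column (p , q) of an additive parity check stands for the additive map 1 ↦ p, ω ↦ q.
_·_ : ∀ {r} → F4 → Column r → Vec F4 r
O · _ = 0ᵛ
I · (p , q) = p
w · (p , q) = q
w² · (p , q) = p +W q

·-distribʳ-⊕ : ∀ {r} a b (h : Column r) → (a ⊕ b) · h ≡ (a · h) +W (b · h)
·-distribʳ-⊕ O b h = sym (+W-identityˡ (b · h))
·-distribʳ-⊕ a O h rewrite ⊕-identityʳ a = sym (+W-identityʳ (a · h))
·-distribʳ-⊕ I I (p , q) = sym (+W-self p)
·-distribʳ-⊕ I w (p , q) = refl
·-distribʳ-⊕ I w² (p , q) = sym (x+[x+y]≡y p q)
·-distribʳ-⊕ w I (p , q) = +W-comm p q
·-distribʳ-⊕ w w (p , q) = sym (+W-self q)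
·-distribʳ-⊕ w w² (p , q) = sym (trans (cong (q +W_) (+W-comm p q)) (x+[x+y]≡y q p))
·-distribʳ-⊕ w² I (p , q) = sym (trans (+W-comm (p +W q) p) (x+[x+y]≡y p q))
·-distribʳ-⊕ w² w (p , q) = trans (·-distribʳ-⊕ w w² (p , q)) (+W-comm q (p +W q))
·-distribʳ-⊕ w² w² (p , q) = sym (+W-self (p +W q))

syndrome : ∀ {r n} → Vec (Column r) n → Vec F4 n → Vec F4 r
syndrome [] [] = 0ᵛ
syndrome (h ∷ H) (a ∷ e) = (a · h) +W syndrome H e

syndrome-0ᵛ : ∀ {r n} (H : Vec (Column r) n) → syndrome H 0ᵛ ≡ 0ᵛ
syndrome-0ᵛ [] = refl
syndrome-0ᵛ (h ∷ H) = trans (+W-identityˡ _) (syndrome-0ᵛ H)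

syndrome-+ : ∀ {r n} (H : Vec (Column r) n) x y →
             syndrome H (x +W y) ≡ syndrome H x +W syndrome H y
syndrome-+ [] [] [] = sym (+W-self 0ᵛ)
syndrome-+ (h ∷ H) (a ∷ x) (b ∷ y) = begin
  ((a ⊕ b) · h) +W syndrome H (x +W y)
    ≡⟨ cong₂ _+W_ (·-distribʳ-⊕ a b h) (syndrome-+ H x y) ⟩
  ((a · h) +W (b · h)) +W (syndrome H x +W syndrome H y)
    ≡⟨ +W-interchange (a · h) (b · h) _ _ ⟩
  ((a · h) +W syndrome H x) +W ((b · h) +W syndrome H y) ∎
  where open ≡-Reasoning

module _ {r n} (H : Vec (Column r) n) (s : Vec F4 r) (k : ℕ) where

  InCoset : Vec F4 n → Set
  InCoset e = syndrome H e ≡ s × wt e ≡ k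

  inCoset? : Decidable InCoset
  inCoset? e = (syndrome H e ≟W s) ×-dec (wt e ≟ k)

  cosetCount : ℕ
  cosetCount = countVecs inCoset?

module _ {r n} (h : Column r) (H : Vec (Column r) n) (s : Vec F4 r) where

  private
    slice : ℕ → F4 → ℕ
    slice k b = countVecs (λ e → inCoset? (h ∷ H) s k (b ∷ e))

    slice≡cosetCount : ∀ b j k → (∀ e → wt (b ∷ e) ≡ j + wt e) →
                       slice (j + k) b ≡ cosetCount H ((b · h) +W s) k
    slice≡cosetCount b j k wt-b =
      count-≐ (λ e → inCoset? (h ∷ H) s (j + k) (b ∷ e)) (inCoset? H ((b · h) +W s) k)
              (to , from) (allVecs F4s n)
      where
      to : ∀ {e} → (syndrome (h ∷ H) (b ∷ e) ≡ s) × (wt (b ∷ e) ≡ j + k) →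
           (syndrome H e ≡ (b · h) +W s) × (wt e ≡ k)
      to {e} (syn≡s , wt≡) = x+y≡z⇒y≡x+z syn≡s , +-cancelˡ-≡ j _ _ (trans (sym (wt-b e)) wt≡)
      from : ∀ {e} → (syndrome H e ≡ (b · h) +W s) × (wt e ≡ k) →
             (syndrome (h ∷ H) (b ∷ e) ≡ s) × (wt (b ∷ e) ≡ j + k)
      from {e} (syn≡ , wt≡) = trans (cong ((b · h) +W_) syn≡) (x+[x+y]≡y (b · h) s)
                            , trans (wt-b e) (cong (j +_) wt≡)

    slice-O : ∀ k → slice k O ≡ cosetCount H s k
    slice-O k = trans (slice≡cosetCount O 0 k (λ _ → refl))
                      (cong (λ s′ → cosetCount H s′ k) (+W-identityˡ s))

  cosetCount-∷-zero : cosetCount (h ∷ H) s 0 ≡ cosetCount H s 0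
  cosetCount-∷-zero = begin
    cosetCount (h ∷ H) s 0
      ≡⟨ count-allVecs-suc (inCoset? (h ∷ H) s 0) F4s ⟩
    slice 0 O + sum (map (slice 0) F4*)
      ≡⟨ cong₂ _+_ (slice-O 0) (cong₂ _+_ (slice-nonzero I (λ _ → refl))
           (cong₂ _+_ (slice-nonzero w (λ _ → refl)) (cong₂ _+_ (slice-nonzero w² (λ _ → refl)) refl))) ⟩
    cosetCount H s 0 + 0
      ≡⟨ +-identityʳ _ ⟩
    cosetCount H s 0 ∎
    where
    open ≡-Reasoning
    slice-nonzero : ∀ b → (∀ e → wt (b ∷ e) ≡ suc (wt e)) → slice 0 b ≡ 0
    slice-nonzero b wt-b = count-none (λ e → inCoset? (h ∷ H) s 0 (b ∷ e))
                                      (λ e (_ , wt≡0) → 1+n≢0 (trans (sym (wt-b e)) wt≡0)) (allVecs F4s n)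

  cosetCount-∷-suc : ∀ k → cosetCount (h ∷ H) s (suc k)
                         ≡ cosetCount H s (suc k) + sum (map (λ b → cosetCount H ((b · h) +W s) k) F4*)
  cosetCount-∷-suc k = begin
    cosetCount (h ∷ H) s (suc k)
      ≡⟨ count-allVecs-suc (inCoset? (h ∷ H) s (suc k)) F4s ⟩
    slice (suc k) O + sum (map (slice (suc k)) F4*)
      ≡⟨ cong₂ _+_ (slice-O (suc k)) (cong₂ _+_ (slice-nonzero I (λ _ → refl))
           (cong₂ _+_ (slice-nonzero w (λ _ → refl)) (cong₂ _+_ (slice-nonzero w² (λ _ → refl)) refl))) ⟩
    cosetCount H s (suc k) + sum (map (λ b → cosetCount H ((b · h) +W s) k) F4*) ∎
    where
    open ≡-Reasoning
    slice-nonzero : ∀ b → (∀ e → wt (b ∷ e) ≡ suc (wt e)) →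
                    slice (suc k) b ≡ cosetCount H ((b · h) +W s) k
    slice-nonzero b = slice≡cosetCount b 1 k

-- Tries rather than functions, so that each table entry is evaluated only once.
data Trie : ℕ → Set where
  leaf : ℕ → Trie 0
  node : ∀ {r} → Trie r → Trie r → Trie r → Trie r → Trie (suc r)

lookupT : ∀ {r} → Trie r → Vec F4 r → ℕ
lookupT (leaf m) [] = m
lookupT (node t _ _ _) (O ∷ s) = lookupT t s
lookupT (node _ t _ _) (I ∷ s) = lookupT t s
lookupT (node _ _ t _) (w ∷ s) = lookupT t s
lookupT (node _ _ _ t) (w² ∷ s) = lookupT t s

tabulateT : ∀ {r} → (Vec F4 r → ℕ) → Trie r
tabulateT {zero} f = leaf (f [])
tabulateT {suc r} f =
  node (tabulateT (f ∘ (O ∷_))) (tabulateT (f ∘ (I ∷_))) (tabulateT (f ∘ (w ∷_))) (tabulateT (f ∘ (w² ∷_)))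

lookupT∘tabulateT : ∀ {r} (f : Vec F4 r → ℕ) s → lookupT (tabulateT f) s ≡ f s
lookupT∘tabulateT f [] = refl
lookupT∘tabulateT f (O ∷ s) = lookupT∘tabulateT (f ∘ (O ∷_)) s
lookupT∘tabulateT f (I ∷ s) = lookupT∘tabulateT (f ∘ (I ∷_)) s
lookupT∘tabulateT f (w ∷ s) = lookupT∘tabulateT (f ∘ (w ∷_)) s
lookupT∘tabulateT f (w² ∷ s) = lookupT∘tabulateT (f ∘ (w² ∷_)) s

data Tabulates {r n} (H : Vec (Column r) n) : ℕ → ∀ {K} → Vec (Trie r) K → Set where
  []  : ∀ {j} → Tabulates H j []
  _∷_ : ∀ {j K t} {ts : Vec (Trie r) K} →
        (∀ s → lookupT t s ≡ cosetCount H s j) → Tabulates H (suc j) ts → Tabulates H j (t ∷ ts)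

module _ {r n} (H : Vec (Column r) n) where

  directTables : ℕ → (K : ℕ) → Vec (Trie r) K
  directTables j zero = []
  directTables j (suc K) = tabulateT (λ s → cosetCount H s j) ∷ directTables (suc j) K

  directTables-tabulates : ∀ j K → Tabulates H j (directTables j K)
  directTables-tabulates j zero = []
  directTables-tabulates j (suc K) = lookupT∘tabulateT _ ∷ directTables-tabulates (suc j) K

module _ {r} (h : Column r) where

  extendTable : Trie r → Trie r → Trie r
  extendTable p t = tabulateT (λ s → lookupT t s + sum (map (λ b → lookupT p ((b · h) +W s)) F4*))

  addColumn′ : ∀ {K} → Trie r → Vec (Trie r) K → Vec (Trie r) K
  addColumn′ p [] = []
  addColumn′ p (t ∷ ts) = extendTable p t ∷ addColumn′ t ts

  addColumn : ∀ {K} → Vec (Trie r) (suc K) → Vec (Trie r) (suc K)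
  addColumn (t ∷ ts) = t ∷ addColumn′ t ts

  module _ {n} {H : Vec (Column r) n} where

    addColumn′-tabulates : ∀ {j K p} {ts : Vec (Trie r) K} →
                           Tabulates H j (p ∷ ts) → Tabulates (h ∷ H) (suc j) (addColumn′ p ts)
    addColumn′-tabulates (_ ∷ []) = []
    addColumn′-tabulates {j} {p = p} {t ∷ _} (p-tab ∷ t-tab ∷ ts-tab) =
      extended-tab ∷ addColumn′-tabulates (t-tab ∷ ts-tab)
      where
      extended-tab : ∀ s → lookupT (extendTable p t) s ≡ cosetCount (h ∷ H) s (suc j)
      extended-tab s = begin
        lookupT (extendTable p t) s
          ≡⟨ lookupT∘tabulateT _ s ⟩
        lookupT t s + sum (map (λ b → lookupT p ((b · h) +W s)) F4*)
          ≡⟨ cong₂ _+_ (t-tab s) (cong sum (map-cong (λ b → p-tab ((b · h) +W s)) F4*)) ⟩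
        cosetCount H s (suc j) + sum (map (λ b → cosetCount H ((b · h) +W s) j) F4*)
          ≡⟨ cosetCount-∷-suc h H s j ⟨
        cosetCount (h ∷ H) s (suc j) ∎
        where open ≡-Reasoning

    addColumn-tabulates : ∀ {K} {ts : Vec (Trie r) (suc K)} →
                          Tabulates H 0 ts → Tabulates (h ∷ H) 0 (addColumn ts)
    addColumn-tabulates tabs@(t-tab ∷ _) =
      (λ s → trans (t-tab s) (sym (cosetCount-∷-zero h H s))) ∷ addColumn′-tabulates tabs

cosetTables : ∀ {r n} → Vec (Column r) n → (K : ℕ) → Vec (Trie r) (suc K)
cosetTables [] K = directTables [] 0 (suc K)
cosetTables (h ∷ H) K = addColumn h (cosetTables H K)

cosetTables-tabulates : ∀ {r n} (H : Vec (Column r) n) K → Tabulates H 0 (cosetTables H K)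
cosetTables-tabulates [] K = directTables-tabulates [] 0 (suc K)
cosetTables-tabulates (h ∷ H) K = addColumn-tabulates h (cosetTables-tabulates H K)

lookups : ∀ {r K} → Vec (Trie r) K → Vec F4 r → Vec ℕ K
lookups ts s = mapᵛ (λ t → lookupT t s) ts

profile : (ℕ → ℕ) → ℕ → (K : ℕ) → Vec ℕ K
profile N j zero = []
profile N j (suc K) = N j ∷ profile N (suc j) K

lookups-tabulates : ∀ {r n K j} {H : Vec (Column r) n} {ts : Vec (Trie r) K} →
                    Tabulates H j ts → ∀ s → lookups ts s ≡ profile (cosetCount H s) j K
lookups-tabulates [] s = refl
lookups-tabulates (t-tab ∷ ts-tab) s = cong₂ _∷_ (t-tab s) (lookups-tabulates ts-tab s)

Packed : ℕ → ℕ → Vec ℕ 4 → Set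
Packed λ′ μ (n₀ ∷ n₁ ∷ n₂ ∷ n₃ ∷ []) = n₀ ≡ 0 → n₁ ≡ 0 → (n₂ ≢ 0 → n₃ ≡ λ′) × (n₂ ≡ 0 → n₃ ≡ μ)

packed? : ∀ λ′ μ → Decidable (Packed λ′ μ)
packed? λ′ μ (n₀ ∷ n₁ ∷ n₂ ∷ n₃ ∷ []) =
  n₀ ≟ 0 →-dec n₁ ≟ 0 →-dec (¬? (n₂ ≟ 0) →-dec n₃ ≟ λ′) ×-dec (n₂ ≟ 0 →-dec n₃ ≟ μ)

H₀ : Vec (Column 5) 11
H₀ = (w² ∷ w² ∷ w² ∷ O ∷ w ∷ [] , w ∷ I ∷ w ∷ w ∷ w ∷ [])
   ∷ (I ∷ I ∷ I ∷ w² ∷ w² ∷ [] , w ∷ w² ∷ O ∷ w² ∷ w ∷ [])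
   ∷ (w ∷ w² ∷ w² ∷ w ∷ O ∷ [] , I ∷ O ∷ I ∷ I ∷ I ∷ [])
   ∷ (w ∷ O ∷ w ∷ w² ∷ w² ∷ [] , w ∷ I ∷ I ∷ I ∷ O ∷ [])
   ∷ (O ∷ w² ∷ w² ∷ I ∷ I ∷ [] , I ∷ w ∷ w² ∷ O ∷ w² ∷ [])
   ∷ (w² ∷ w ∷ O ∷ w² ∷ w² ∷ [] , O ∷ w ∷ w ∷ w ∷ I ∷ [])
   ∷ (I ∷ O ∷ O ∷ O ∷ O ∷ [] , w ∷ O ∷ O ∷ O ∷ O ∷ [])
   ∷ (O ∷ I ∷ O ∷ O ∷ O ∷ [] , O ∷ w ∷ O ∷ O ∷ O ∷ [])
   ∷ (O ∷ O ∷ I ∷ O ∷ O ∷ [] , O ∷ O ∷ w ∷ O ∷ O ∷ [])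
   ∷ (O ∷ O ∷ O ∷ I ∷ O ∷ [] , O ∷ O ∷ O ∷ w ∷ O ∷ [])
   ∷ (O ∷ O ∷ O ∷ O ∷ I ∷ [] , O ∷ O ∷ O ∷ O ∷ w ∷ [])
   ∷ []

-- The tables are an argument so that they are shared between all syndromes.
lookupsPacked? : ∀ {r} (ts : Vec (Trie r) 4) → Dec (∀ s → Packed 4 5 (lookups ts s))
lookupsPacked? ts = all-Vec? (λ s → packed? 4 5 (lookups ts s))

everyCoset-packed : ∀ s → Packed 4 5 (profile (cosetCount H₀ s) 0 4)
everyCoset-packed s = subst (Packed 4 5) (lookups-tabulates (cosetTables-tabulates H₀ 3) s)
                            (from-yes (lookupsPacked? (cosetTables H₀ 3)) s)

syn : Word → Vec F4 5
syn = syndrome H₀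

comb-syndrome : ∀ {r} (H : Vec (Column r) 11) {k} (c : Vec Bool k) {gs : Vec Word k} →
                AllV.All (λ g → syndrome H g ≡ 0ᵛ) gs → syndrome H (comb c gs) ≡ 0ᵛ
comb-syndrome H [] AllV.[] = syndrome-0ᵛ H
comb-syndrome H (true ∷ c) {g ∷ gs} (g-syn AllV.∷ gs-syn) =
  trans (syndrome-+ H g (comb c gs)) (trans (cong₂ _+W_ g-syn (comb-syndrome H c gs-syn)) (+W-self 0ᵛ))
comb-syndrome H (false ∷ c) (_ AllV.∷ gs-syn) = comb-syndrome H c gs-syn

gens-syn≡0 : AllV.All (λ g → syn g ≡ 0ᵛ) gens
gens-syn≡0 = from-yes (AllV.all? (λ g → syn g ≟W 0ᵛ) gens)

∈D⇒syn≡0 : ∀ {x} → x ∈D → syn x ≡ 0ᵛ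
∈D⇒syn≡0 (c , refl) = comb-syndrome H₀ c gens-syn≡0

_⊻_ : ∀ {k} → Vec Bool k → Vec Bool k → Vec Bool k
_⊻_ = zipWith _xor_

gensOf : List ℕ → Vec Bool 12
gensOf is = tabulate (λ i → any (toℕ i ≡ᵇ_) is)

-- The i-th pair selects combinations of generators whose first six coordinates are eᵢ and ω eᵢ.
preimages : Vec (Vec Bool 12 × Vec Bool 12) 6
preimages = (gensOf (0 ∷ 1 ∷ 2 ∷ []) , gensOf (3 ∷ []))
          ∷ (gensOf (4 ∷ []) , gensOf (0 ∷ 5 ∷ []))
          ∷ (gensOf (1 ∷ 6 ∷ []) , gensOf (1 ∷ 7 ∷ []))
          ∷ (gensOf (1 ∷ 8 ∷ []) , gensOf (0 ∷ 9 ∷ []))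
          ∷ (gensOf (0 ∷ 10 ∷ []) , gensOf (1 ∷ 11 ∷ []))
          ∷ (gensOf (0 ∷ 1 ∷ []) , gensOf (1 ∷ []))
          ∷ []

lift : Vec F4 6 → Vec Bool 12
lift t = foldr′ _⊻_ (replicate _ false) (zipWith select t preimages)
  where
  select : F4 → Vec Bool 12 × Vec Bool 12 → Vec Bool 12
  select O _ = replicate _ false
  select I (p , q) = p
  select w (p , q) = q
  select w² (p , q) = p ⊻ q

take-lift : ∀ t → take 6 (comb (lift t) gens) ≡ t
take-lift = from-yes (all-Vec? λ t → take 6 (comb (lift t) gens) ≟W t)

syn-padded : ∀ v → syn (0ᵛ {6} ++ᵛ v) ≡ v
syn-padded = from-yes (all-Vec? λ v → syn (0ᵛ {6} ++ᵛ v) ≟W v)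

syn≡0⇒∈D : ∀ y → syn y ≡ 0ᵛ → y ∈D
syn≡0⇒∈D y syn-y = c , sym (x+y≡0⇒x≡y z≡0)
  where
  c = lift (take 6 y)
  z = y +W comb c gens
  take-z : take 6 z ≡ 0ᵛ
  take-z = begin
    take 6 z                                ≡⟨ take-zipWith _⊕_ y (comb c gens) ⟩
    take 6 y +W take 6 (comb c gens)        ≡⟨ cong (take 6 y +W_) (take-lift (take 6 y)) ⟩
    take 6 y +W take 6 y                    ≡⟨ +W-self (take 6 y) ⟩
    0ᵛ                                      ∎
    where open ≡-Reasoning
  syn-z : syn z ≡ 0ᵛ
  syn-z = trans (syndrome-+ H₀ y (comb c gens)) (cong₂ _+W_ syn-y (∈D⇒syn≡0 (c , refl)))
  padded : z ≡ 0ᵛ {6} ++ᵛ drop 6 z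
  padded = trans (sym (take++drop≡id 6 z)) (cong (_++ᵛ drop 6 z) take-z)
  drop-z : drop 6 z ≡ 0ᵛ
  drop-z = trans (sym (syn-padded (drop 6 z))) (trans (cong syn (sym padded)) syn-z)
  z≡0 : z ≡ 0ᵛ
  z≡0 = trans padded (cong (0ᵛ {6} ++ᵛ_) drop-z)

∈-Bools : ∀ b → b ∈ (true ∷ false ∷ [])
∈-Bools true = here refl
∈-Bools false = there (here refl)

∈D⇒Any : ∀ {x} → x ∈D → Any (λ c → comb c gens ≡ x) allCoeffs
∈D⇒Any (c , eq) = lose (∈-allVecs ∈-Bools c) eq

atDist? : ∀ k x → Decidable (λ y → Any (λ c → comb c gens ≡ y) allCoeffs × dist x y ≡ k)
atDist? k x y = ∈D? y ×-dec (dist x y ≟ k)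

countAtDist≡cosetCount : ∀ k x → countAtDist k x ≡ cosetCount H₀ (syn x) k
countAtDist≡cosetCount k x = begin
  count (atDist? k x) allWords
    ≡⟨ count-≐ (atDist? k x) near? (by-syndrome , from-syndrome) allWords ⟩
  countVecs near?
    ≡⟨ countVecs-translate near? x ⟩
  countVecs (near? ∘ (x +W_))
    ≡⟨ count-≐ (near? ∘ (x +W_)) (inCoset? H₀ (syn x) k) (to-coset , from-coset) allWords ⟩
  cosetCount H₀ (syn x) k ∎
  where
  open ≡-Reasoning
  near? : Decidable (λ y → syn y ≡ 0ᵛ × wt (x +W y) ≡ k)
  near? y = (syn y ≟W 0ᵛ) ×-dec (wt (x +W y) ≟ k)
  by-syndrome : ∀ {y} → Any (λ c → comb c gens ≡ y) allCoeffs × dist x y ≡ k →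
                syn y ≡ 0ᵛ × wt (x +W y) ≡ k
  by-syndrome {y} (y∈D , d≡k) = ∈D⇒syn≡0 (satisfied y∈D) , trans (sym (dist≡wt x y)) d≡k
  from-syndrome : ∀ {y} → syn y ≡ 0ᵛ × wt (x +W y) ≡ k →
                  Any (λ c → comb c gens ≡ y) allCoeffs × dist x y ≡ k
  from-syndrome {y} (syn≡0 , wt≡k) = ∈D⇒Any (syn≡0⇒∈D y syn≡0) , trans (dist≡wt x y) wt≡k
  to-coset : ∀ {e} → syn (x +W e) ≡ 0ᵛ × wt (x +W (x +W e)) ≡ k → InCoset H₀ (syn x) k e
  to-coset {e} (syn≡0 , wt≡k) = sym (x+y≡0⇒x≡y (trans (sym (syndrome-+ H₀ x e)) syn≡0))
                              , trans (cong wt (sym (x+[x+y]≡y x e))) wt≡k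
  from-coset : ∀ {e} → InCoset H₀ (syn x) k e → syn (x +W e) ≡ 0ᵛ × wt (x +W (x +W e)) ≡ k
  from-coset {e} (syn≡ , wt≡k) = trans (syndrome-+ H₀ x e)
                                       (trans (cong (syn x +W_) syn≡) (+W-self (syn x)))
                               , trans (cong wt (x+[x+y]≡y x e)) wt≡k

countAtDist-below : ∀ {m} k x → (∀ c → c ∈D → m ≤ dist x c) → k < m → countAtDist k x ≡ 0
countAtDist-below {m} k x far k<m =
  count-none (atDist? k x) (λ y (y∈D , d≡k) → ≤⇒≯ (subst (m ≤_) d≡k (far y (satisfied y∈D))) k<m)
             allWords

countAtDist-attained : ∀ {c} k x → c ∈D → dist x c ≡ k → countAtDist k x ≢ 0
countAtDist-attained {c} k x c∈D d≡k =
  n>0⇒n≢0 (count-some (atDist? k x) (∈-allVecs ∈-F4s c) (∈D⇒Any c∈D , d≡k))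

distanceProfile-packed : ∀ x → Packed 4 5 (profile (λ k → countAtDist k x) 0 4)
distanceProfile-packed x = subst (Packed 4 5) (sym (profile-cong 0 4)) (everyCoset-packed (syn x))
  where
  profile-cong : ∀ j K → profile (λ k → countAtDist k x) j K ≡ profile (cosetCount H₀ (syn x)) j K
  profile-cong j zero = refl
  profile-cong j (suc K) = cong₂ _∷_ (countAtDist≡cosetCount j x) (profile-cong (suc j) K)

theorem4 : (x : Word) →
    (((Σ Word λ c → c ∈D × dist x c ≡ 2) × (∀ c → c ∈D → 2 ≤ dist x c)) → countAtDist 3 x ≡ 4)
    × ((∀ c → c ∈D → 3 ≤ dist x c) → countAtDist 3 x ≡ 5)
theorem4 x = atDistance2 , beyondDistance2
  where
  packed : Packed 4 5 (profile (λ k → countAtDist k x) 0 4)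
  packed = distanceProfile-packed x
  atDistance2 : ((Σ Word λ c → c ∈D × dist x c ≡ 2) × (∀ c → c ∈D → 2 ≤ dist x c)) → countAtDist 3 x ≡ 4
  atDistance2 ((c , c∈D , d≡2) , far) =
    proj₁ (packed (countAtDist-below 0 x far z<s) (countAtDist-below 1 x far (s<s z<s)))
          (countAtDist-attained 2 x c∈D d≡2)
  beyondDistance2 : (∀ c → c ∈D → 3 ≤ dist x c) → countAtDist 3 x ≡ 5
  beyondDistance2 far =
    proj₂ (packed (countAtDist-below 0 x far z<s) (countAtDist-below 1 x far (s<s z<s)))
          (countAtDist-below 2 x far (s<s (s<s z<s)))
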